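{- Let $T$ be a tree with $\ell$ leaves, let $L(T)$ be its set of leaves, and let $v$ be a vertex of $T$. Then $T$ has a covering by $\lceil \ell/2\rceil$ paths each containing $v$ if and only if $|V(T')\cap L(T)|\leq\lceil \ell/2\rceil$ for every connected component $T'$ of $T-v$.
   Context: A covering of a graph $G$ is a set of connected subgraphs of $G$ (here paths) such that every edge of $G$ lies in at least one of them. -}

module Defs where

open import Data.Nat using (ℕ; _≤_; _≡ᵇ_; ⌈_/2⌉)
open import Data.Fin using (Fin)
open import Data.Bool using (Bool; true; false)
open import Data.List using (List; []; _∷_; _++_; length; filterᵇ; allFin)
open import Data.List.Relation.Unary.Linked using (Linked)
open import Data.List.Relation.Unary.All using (All)
open import Data.List.Relation.Unary.Unique.Propositional using (Unique)
open import Data.List.Membership.Propositional using (_∈_)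
open import Data.Product using (Σ; _×_; ∃)
open import Data.Sum using (_⊎_)
open import Data.Unit using (⊤)
open import Relation.Nullary using (¬_)
open import Relation.Binary.PropositionalEquality using (_≡_; _≢_)

record Graph (n : ℕ) : Set where
  field
    adj    : Fin n → Fin n → Bool
    sym    : ∀ x y → adj x y ≡ adj y x
    irrefl : ∀ x → adj x x ≡ false
open Graph public

module _ {n : ℕ} (G : Graph n) where

  Edge : Fin n → Fin n → Set
  Edge x y = adj G x y ≡ true

  degree : Fin n → ℕ
  degree x = length (filterᵇ (adj G x) (allFin n))

  IsLeaf : Fin n → Set
  IsLeaf x = degree x ≡ 1

  leafCount : ℕ
  leafCount = length (filterᵇ (λ x → degree x ≡ᵇ 1) (allFin n))

  IsPath : List (Fin n) → Set
  IsPath xs = (xs ≢ []) × Linked Edge xs × Unique xs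

  record Path : Set where
    field
      verts  : List (Fin n)
      isPath : IsPath verts


  -- walks inside the subgraph induced by the vertices satisfying P
  data ReachIn (P : Fin n → Set) : Fin n → Fin n → Set where
    here  : ∀ {u} → P u → ReachIn P u u
    there : ∀ {u x w} → P u → Edge u x → ReachIn P x w → ReachIn P u w

  Connected : Set
  Connected = ∀ u w → ReachIn (λ _ → ⊤) u w

  Acyclic : Set
  Acyclic = ∀ x (mid : List (Fin n)) y →
            IsPath (x ∷ mid ++ y ∷ []) → 1 ≤ length mid → ¬ Edge y x

  IsTree : Set
  IsTree = Connected × Acyclic

data Consec {n : ℕ} (x y : Fin n) : List (Fin n) → Set where
  here  : ∀ {zs} → Consec x y (x ∷ y ∷ zs)
  there : ∀ {z zs} → Consec x y zs → Consec x y (z ∷ zs)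

EdgeInPath : ∀ {n} {G : Graph n} → Fin n → Fin n → Path G → Set
EdgeInPath x y p = Consec x y (Path.verts p) ⊎ Consec y x (Path.verts p)

CoveringThrough : ∀ {n} (G : Graph n) (k : ℕ) (v : Fin n) → Set
CoveringThrough G k v =
  Σ (Fin k → Path G) λ ps →
    (∀ i → v ∈ Path.verts (ps i)) ×
    (∀ x y → Edge G x y → ∃ λ i → EdgeInPath {G = G} x y (ps i))

-- The component of G - v containing u is the set of w
-- reachable from u by a walk avoiding v; "at most k" is stated as: every
-- duplicate-free list of such leaves has length ≤ k.
ComponentsLeafBounded : ∀ {n} (G : Graph n) (k : ℕ) (v : Fin n) → Set
ComponentsLeafBounded {n} G k v =
  ∀ (u : Fin n) (ws : List (Fin n)) → Unique ws →
    All (λ w → IsLeaf G w × ReachIn G (λ x → x ≢ v) u w) ws →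
    length ws ≤ k

module Submission where

-- (⇒) A leaf lies on a path only as one of its ends, so every leaf is an end
-- of the covering path containing its edge.  The two ends of a path through
-- v lie in different components of T - v, since otherwise two neighbours of
-- v would be joined avoiding v, closing a cycle.  So the leaves of one
-- component are ends of pairwise different paths: there are at most k.
--
-- (⇐) Let ray x be the path from v to x and key x its vertex after v, which
-- names the component of T - v containing x.  Every edge lies on the ray of
-- a leaf ≠ v (walk away from v until a leaf is reached).  A general pairing
-- lemma groups the at most 2k leaves ≠ v into at most k singletons and pairs
-- of different keys, since at most k leaves share a key; the two rays of a
-- pair meet only in v, so their union is a path through v.

open import Data.Bool using (T; T?)
open import Data.Bool.Properties using (T-≡)
open import Data.Empty using (⊥; ⊥-elim)
open import Data.Fin using (Fin; zero; suc; toℕ; _≟_)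
open import Data.Fin.Properties using (toℕ-injective)
open import Data.List using (List; []; _∷_; _++_; length; reverse; take; drop; filter; filterᵇ; allFin)
open import Data.List.Properties
  using (length-++; length-++-sucʳ; ++-assoc; ++-identityʳ; unfold-reverse; length-tabulate;
         length-take; length-drop; take++drop≡id)
open import Data.List.Membership.Propositional using (_∈_; _∉_)
open import Data.List.Membership.Propositional.Properties
  using (∈-∃++; ∈-++⁺ˡ; ∈-++⁺ʳ; ∈-++⁻; ∈-filter⁺; ∈-filter⁻; ∈-allFin)
import Data.List.Membership.DecPropositional as DecMembership
open import Data.List.Relation.Binary.Disjoint.Propositional using (Disjoint)
open import Data.List.Relation.Binary.Permutation.Propositional using (_↭_; ↭⇒↭ₛ; ↭-sym)
open import Data.List.Relation.Binary.Permutation.Propositional.Properties using (↭-reverse; ∈-resp-↭; ↭-length)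
import Data.List.Relation.Binary.Permutation.Setoid.Properties as PermSetoid
open import Data.List.Relation.Unary.All as All using (All; []; _∷_)
import Data.List.Relation.Unary.All.Properties as AllP
open import Data.List.Relation.Unary.AllPairs using (AllPairs; []; _∷_)
open import Data.List.Relation.Unary.Any using (Any; here; there)
import Data.List.Relation.Unary.Any.Properties as Any
open import Data.List.Relation.Unary.Linked using (Linked; [-]; _∷_)
open import Data.List.Relation.Unary.Linked.Properties using (Linked⇒AllPairs)
open import Data.List.Relation.Unary.Unique.Propositional using (Unique)
open import Data.List.Relation.Unary.Unique.Propositional.Properties using (Unique[x∷xs]⇒x∉xs; filter⁺; allFin⁺)
import Data.List.Relation.Unary.Unique.Propositional.Properties as UniqueP
open import Data.Nat using (ℕ; zero; suc; _+_; _≤_; _<_; z≤n; s≤s; _≤?_; _≡ᵇ_; ⌈_/2⌉)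
open import Data.Nat.Properties
  using (≤-trans; ≤-reflexive; ≤-antisym; 1+n≰n; <⇒≤; ≰⇒>; +-suc; +-identityʳ; +-monoˡ-≤; m≤n+m;
         m≤n⇒m⊓n≡m; m≤n+o⇒m∸n≤o; ≡⇒≡ᵇ; ⌊n/2⌋+⌈n/2⌉≡n; ⌊n/2⌋≤⌈n/2⌉; ≤-decTotalOrder)
  renaming (_≟_ to _≟ℕ_)
open import Data.Product as Product using (Σ; _×_; _,_; ∃; ∃₂; proj₁; proj₂)
open import Data.Sum as Sum using (_⊎_; inj₁; inj₂)
open import Data.Unit using (⊤)
open import Function using (_∘_; id)
open import Function.Bundles using (Equivalence; _⇔_; mk⇔)
open import Relation.Binary.PropositionalEquality
  using (_≡_; _≢_; refl; sym; trans; cong; subst; subst₂; setoid; module ≡-Reasoning)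
import Relation.Binary.Construct.On as On
open import Relation.Nullary using (¬_; ¬?; yes; no; _×-dec_)

open import Defs hiding (sym)

module _ {A : Set} where

  unique-length≤ : ∀ {xs ys : List A} → Unique xs → All (_∈ ys) xs → length xs ≤ length ys
  unique-length≤ {[]} _ _ = z≤n
  unique-length≤ {x ∷ xs} (x∉xs ∷ U) (x∈ys ∷ xs⊆ys) with pre , suf , refl ← ∈-∃++ x∈ys =
    subst (suc (length xs) ≤_) (sym (length-++-sucʳ pre x suf))
      (s≤s (unique-length≤ U (All.map (λ (x≢z , z∈) → ∈-remove pre suf z∈ (x≢z ∘ sym))
                                        (All.zip (x∉xs , xs⊆ys)))))
    where
      ∈-remove : ∀ {z} pre suf → z ∈ pre ++ x ∷ suf → z ≢ x → z ∈ pre ++ suf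
      ∈-remove []        suf (here z≡x) z≢x = ⊥-elim (z≢x z≡x)
      ∈-remove []        suf (there z∈) _   = z∈
      ∈-remove (y ∷ pre) suf (here z≡y) _   = here z≡y
      ∈-remove (y ∷ pre) suf (there z∈) z≢x = there (∈-remove pre suf z∈ z≢x)

  unique-prefix : ∀ xs {ys : List A} → Unique (xs ++ ys) → Unique xs
  unique-prefix []       _         = []
  unique-prefix (x ∷ xs) (x∉ ∷ U) = AllP.++⁻ˡ xs x∉ ∷ unique-prefix xs U

  unique-suffix : ∀ xs {ys : List A} → Unique (xs ++ ys) → Unique ys
  unique-suffix []       U        = U
  unique-suffix (x ∷ xs) (_ ∷ U) = unique-suffix xs U

  unique-disjoint : ∀ xs {ys} {z : A} → Unique (xs ++ ys) → z ∈ xs → z ∈ ys → ⊥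
  unique-disjoint (x ∷ xs) (x∉ ∷ _) (here refl) z∈ys = All.lookup (AllP.++⁻ʳ xs x∉) z∈ys refl
  unique-disjoint (x ∷ xs) (_ ∷ U) (there z∈xs) z∈ys = unique-disjoint xs U z∈xs z∈ys

  unique-↭ : ∀ {xs ys : List A} → xs ↭ ys → Unique xs → Unique ys
  unique-↭ σ = PermSetoid.Unique-resp-↭ (setoid A) (↭⇒↭ₛ σ)

  unique-reverse : ∀ {xs : List A} → Unique xs → Unique (reverse xs)
  unique-reverse {xs} = unique-↭ (↭-sym (↭-reverse xs))

  head-avoided : ∀ {x : A} {xs} → Unique (x ∷ xs) → All (_≢ x) xs
  head-avoided (x∉ ∷ _) = All.map (λ x≢y y≡x → x≢y (sym y≡x)) x∉

  singleton-member : ∀ (xs : List A) → length xs ≡ 1 → ∃ (_∈ xs)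
  singleton-member (x ∷ []) _ = x , here refl

  singleton-members-equal : ∀ {xs : List A} {x y} → length xs ≡ 1 → x ∈ xs → y ∈ xs → x ≡ y
  singleton-members-equal {_ ∷ []} _ (here refl) (here refl) = refl

  another-member : ∀ {p : A} xs → Unique xs → p ∈ xs → length xs ≢ 1 → ∃ λ y → y ∈ xs × y ≢ p
  another-member (a ∷ [])     _ _ len≢1 = ⊥-elim (len≢1 refl)
  another-member (a ∷ b ∷ xs) ((a≢b ∷ _) ∷ _) (here refl) _ = b , there (here refl) , a≢b ∘ sym
  another-member (a ∷ b ∷ xs) U (there p∈) _ =
    a , here refl , λ { refl → Unique[x∷xs]⇒x∉xs U p∈ }

  snoc-length : ∀ (xs : List A) y → length (xs ++ y ∷ []) ≡ suc (length xs)
  snoc-length xs y = trans (length-++-sucʳ xs y []) (cong (suc ∘ length) (++-identityʳ xs))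

module _ {A : Set} (default : A) where

  padded : ∀ {k} → List A → Fin k → A
  padded []       _        = default
  padded (x ∷ xs) zero     = x
  padded (x ∷ xs) (suc i)  = padded xs i

  padded-any : ∀ {k} {P : A → Set} {xs} → length xs ≤ k → Any P xs → ∃ λ (i : Fin k) → P (padded xs i)
  padded-any (s≤s _)   (here p)  = zero , p
  padded-any (s≤s |xs|≤k) (there p) with i , q ← padded-any |xs|≤k p = suc i , q

unique-Fin-length≤ : ∀ {m} {xs : List (Fin m)} → Unique xs → length xs ≤ m
unique-Fin-length≤ {m} {xs} U =
  subst (length xs ≤_) (length-tabulate id) (unique-length≤ U (All.tabulate (λ {i} _ → ∈-allFin i)))

module _ {A : Set} {m : ℕ} (Label : A → Fin m → Set) where

  Separated : List A → Set
  Separated xs = ∀ {x y i} → x ∈ xs → y ∈ xs → Label x i → Label y i → x ≡ y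

  label-list : ∀ {xs} → Unique xs → All (λ x → ∃ (Label x)) xs → Separated xs →
               ∃ λ is → length is ≡ length xs × Unique is × All (λ i → ∃ λ y → y ∈ xs × Label y i) is
  label-list [] [] _ = [] , refl , [] , []
  label-list (x∉ ∷ U) ((i , xi) ∷ ls) sep
    with is , len , Uis , owners ← label-list U ls (λ p q → sep (there p) (there q)) =
    i ∷ is , cong suc len , All.map (i-new) owners ∷ Uis ,
    (_ , here refl , xi) ∷ All.map (λ (y , y∈ , yj) → y , there y∈ , yj) owners
    where
      i-new : ∀ {j} → (∃ λ y → y ∈ _ × Label y j) → i ≢ j
      i-new (y , y∈ , yj) refl = All.lookup x∉ y∈ (sep (here refl) (there y∈) xi yj)

  count-by-labels : ∀ {xs} → Unique xs → All (λ x → ∃ (Label x)) xs → Separated xs → length xs ≤ m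
  count-by-labels U labelled sep with _ , |is|≡|xs| , unique-is , _ ← label-list U labelled sep =
    subst (_≤ m) |is|≡|xs| (unique-Fin-length≤ unique-is)

-- The list is
-- sorted by key and its i-th element is grouped with its (i+k)-th one: the
-- k+1 entries from the first to the second of these cannot all share a key.
module Pairing {X : Set} (κ : X → ℕ) where

  open import Data.List.Sort (On.decTotalOrder ≤-decTotalOrder κ) using (sort; sort-↭; sort-↗)

  data Group : Set where
    single : X → Group
    pair   : (x y : X) → κ x ≢ κ y → Group

  data _∈ᴳ_ : X → Group → Set where
    in-single : ∀ {x} → x ∈ᴳ single x
    in-left   : ∀ {x y d} → x ∈ᴳ pair x y d
    in-right  : ∀ {x y d} → y ∈ᴳ pair x y d

  KeyBounded : ℕ → List X → Set
  KeyBounded k xs = ∀ a ys → Unique ys → All (λ y → y ∈ xs × κ y ≡ κ a) ys → length ys ≤ k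

  keyBounded-⊆ : ∀ {k xs ys} → (∀ {x} → x ∈ ys → x ∈ xs) → KeyBounded k xs → KeyBounded k ys
  keyBounded-⊆ ys⊆xs bound a zs U members = bound a zs U (All.map (λ (z∈ , same) → ys⊆xs z∈ , same) members)

  Sorted : List X → Set
  Sorted = AllPairs (λ x y → κ x ≤ κ y)

  sorted-before : ∀ S {b R} → Sorted (S ++ b ∷ R) → All (λ s → κ s ≤ κ b) S
  sorted-before []      _               = []
  sorted-before (s ∷ S) (s≤ ∷ sorted) = All.lookup s≤ (∈-++⁺ʳ S (here refl)) ∷ sorted-before S sorted

  -- In a sorted key-bounded list, entries at least k positions apart have
  -- different keys: otherwise the k+1 entries from a to b would share a key.
  keys-apart : ∀ {k} a S b R → Sorted (a ∷ S ++ b ∷ R) → Unique (a ∷ S ++ b ∷ R) →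
               KeyBounded k (a ∷ S ++ b ∷ R) → k ≤ suc (length S) → κ a ≢ κ b
  keys-apart {k} a S b R sorted@(a≤ ∷ rest) U bound k≤ κa≡κb =
    1+n≰n (≤-trans too-many k≤)
    where
      window = a ∷ S ++ b ∷ []
      window++R : window ++ R ≡ a ∷ S ++ b ∷ R
      window++R = cong (a ∷_) (++-assoc S (b ∷ []) R)
      same-key : All (λ w → κ w ≡ κ a) window
      same-key = refl ∷ AllP.++⁺ (All.zipWith squeeze (AllP.++⁻ˡ S a≤ , sorted-before S rest)) (sym κa≡κb ∷ [])
        where
          squeeze : ∀ {s} → κ a ≤ κ s × κ s ≤ κ b → κ s ≡ κ a
          squeeze {s} (a≤s , s≤b) = ≤-antisym (subst (κ s ≤_) (sym κa≡κb) s≤b) a≤s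
      too-many : suc (suc (length S)) ≤ k
      too-many = subst (_≤ k) (cong suc (snoc-length S b))
        (bound a window (unique-prefix window (subst Unique (sym window++R) U))
          (All.tabulate (λ {w} w∈ → subst (w ∈_) window++R (∈-++⁺ˡ w∈) , All.lookup same-key w∈)))

  module _ (k : ℕ) where

    Grouping : List X → Set
    Grouping xs = ∃ λ gs → length gs ≤ k × (∀ {x} → x ∈ xs → Any (x ∈ᴳ_) gs)

    -- The sorted list still to be grouped is A ++ M ++ B: each entry of A is
    -- grouped with the entry of B in the same position (alone if there is
    -- none), and the gap M makes the head of B lie k positions after the
    -- head of A.
    group-up : ∀ A M B → Sorted (A ++ M ++ B) → Unique (A ++ M ++ B) → KeyBounded k (A ++ M ++ B) →
               length B ≤ length A → B ≡ [] ⊎ length A + length M ≡ k →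
               ∃ λ gs → length gs ≡ length A × (∀ {x} → x ∈ A ++ B → Any (x ∈ᴳ_) gs)
    group-up []      M []      _ _ _ _ _ = [] , refl , λ ()
    group-up (a ∷ A) M [] (_ ∷ sorted) (_ ∷ U) bound _ _
      with gs , len , grouped ← group-up A M [] sorted U (keyBounded-⊆ there bound) z≤n (inj₁ refl) =
      single a ∷ gs , cong suc len , λ { (here refl) → here in-single ; (there x∈) → there (grouped x∈) }
    group-up (a ∷ A) M (b ∷ B) _ _ _ _ (inj₁ ())
    group-up (a ∷ A) M (b ∷ B) sorted@(_ ∷ sorted′) U@(_ ∷ U′) bound (s≤s |B|≤|A|) (inj₂ |aA|+|M|≡k) =
      pair a b apart ∷ gs , cong suc len , regroup
      where
        shift : A ++ M ++ b ∷ B ≡ A ++ (M ++ b ∷ []) ++ B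
        shift = cong (A ++_) (sym (++-assoc M (b ∷ []) B))
        |A|+|Mb|≡k : length A + length (M ++ b ∷ []) ≡ k
        |A|+|Mb|≡k = begin
          length A + length (M ++ b ∷ []) ≡⟨ cong (length A +_) (snoc-length M b) ⟩
          length A + suc (length M)       ≡⟨ +-suc (length A) (length M) ⟩
          suc (length A + length M)       ≡⟨ |aA|+|M|≡k ⟩
          k                               ∎
          where open ≡-Reasoning
        regroupAM : a ∷ A ++ M ++ b ∷ B ≡ a ∷ (A ++ M) ++ b ∷ B
        regroupAM = cong (a ∷_) (sym (++-assoc A M (b ∷ B)))
        apart : κ a ≢ κ b
        apart = keys-apart a (A ++ M) b B (subst Sorted regroupAM sorted) (subst Unique regroupAM U)
                  (subst (KeyBounded k) regroupAM bound)
                  (≤-reflexive (trans (sym |aA|+|M|≡k) (cong suc (sym (length-++ A)))))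
        rest : ∃ λ gs → length gs ≡ length A × (∀ {x} → x ∈ A ++ B → Any (x ∈ᴳ_) gs)
        rest = group-up A (M ++ b ∷ []) B (subst Sorted shift sorted′) (subst Unique shift U′)
                 (subst (KeyBounded k) shift (keyBounded-⊆ there bound)) |B|≤|A| (inj₂ |A|+|Mb|≡k)
        gs = proj₁ rest
        len = proj₁ (proj₂ rest)
        grouped = proj₂ (proj₂ rest)
        regroup : ∀ {x} → x ∈ a ∷ A ++ b ∷ B → Any (x ∈ᴳ_) (pair a b apart ∷ gs)
        regroup (here refl) = here in-left
        regroup (there x∈) with ∈-++⁻ A x∈
        ... | inj₁ x∈A          = there (grouped (∈-++⁺ˡ x∈A))
        ... | inj₂ (here refl)  = here in-right
        ... | inj₂ (there x∈B)  = there (grouped (∈-++⁺ʳ A x∈B))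

    from-halves : ∀ xs A B → sort xs ≡ A ++ B → Unique xs → KeyBounded k xs →
                  length A ≤ k → length B ≤ length A → B ≡ [] ⊎ length A + 0 ≡ k → Grouping xs
    from-halves xs A B sorted≡A++B U bound |A|≤k |B|≤|A| balanced
      with gs , len , grouped ←
             group-up A [] B (subst Sorted sorted≡A++B (Linked⇒AllPairs ≤-trans (sort-↗ xs)))
                      (subst Unique sorted≡A++B (unique-↭ (↭-sym (sort-↭ xs)) U))
                      (subst (KeyBounded k) sorted≡A++B (keyBounded-⊆ (∈-resp-↭ (sort-↭ xs)) bound))
                      |B|≤|A| balanced =
      gs , subst (_≤ k) (sym len) |A|≤k ,
      λ {x} x∈ → grouped (subst (x ∈_) sorted≡A++B (∈-resp-↭ (↭-sym (sort-↭ xs)) x∈))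

    pairing : ∀ xs → Unique xs → length xs ≤ k + k → KeyBounded k xs → Grouping xs
    pairing xs U |xs|≤2k bound with k ≤? length (sort xs)
    ... | yes k≤|ys| =
      from-halves xs (take k ys) (drop k ys) (sym (take++drop≡id k ys)) U bound (≤-reflexive |A|≡k) |B|≤|A|
        (inj₂ (trans (+-identityʳ _) |A|≡k))
      where
        ys = sort xs
        |A|≡k : length (take k ys) ≡ k
        |A|≡k = trans (length-take k ys) (m≤n⇒m⊓n≡m k≤|ys|)
        |B|≤|A| : length (drop k ys) ≤ length (take k ys)
        |B|≤|A| = subst₂ _≤_ (sym (length-drop k ys)) (sym |A|≡k)
                    (m≤n+o⇒m∸n≤o (length ys) k (subst (_≤ k + k) (sym (↭-length (sort-↭ xs))) |xs|≤2k))
    ... | no k≰|ys| =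
      from-halves xs (sort xs) [] (sym (++-identityʳ _)) U bound (<⇒≤ (≰⇒> k≰|ys|)) z≤n (inj₁ refl)

module _ {n : ℕ} where

  consec-++ˡ : ∀ {a b : Fin n} {xs} ys → Consec a b xs → Consec a b (xs ++ ys)
  consec-++ˡ ys here      = here
  consec-++ˡ ys (there c) = there (consec-++ˡ ys c)

  consec-++ʳ : ∀ {a b : Fin n} xs {ys} → Consec a b ys → Consec a b (xs ++ ys)
  consec-++ʳ []       c = c
  consec-++ʳ (x ∷ xs) c = there (consec-++ʳ xs c)

  consec-reverse : ∀ {a b : Fin n} {xs} → Consec a b xs → Consec b a (reverse xs)
  consec-reverse {a} {b} (here {zs}) = subst (Consec b a) (sym reverse-ab-zs) (consec-++ʳ (reverse zs) here)
    where
      open ≡-Reasoning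
      reverse-ab-zs : reverse (a ∷ b ∷ zs) ≡ reverse zs ++ b ∷ a ∷ []
      reverse-ab-zs = begin
        reverse (a ∷ b ∷ zs)              ≡⟨ unfold-reverse a (b ∷ zs) ⟩
        reverse (b ∷ zs) ++ a ∷ []        ≡⟨ cong (_++ a ∷ []) (unfold-reverse b zs) ⟩
        (reverse zs ++ b ∷ []) ++ a ∷ []  ≡⟨ ++-assoc (reverse zs) (b ∷ []) (a ∷ []) ⟩
        reverse zs ++ b ∷ a ∷ []          ∎
  consec-reverse (there {z} {zs} c) =
    subst (Consec _ _) (sym (unfold-reverse z zs)) (consec-++ˡ (z ∷ []) (consec-reverse c))

  consec-∈ : ∀ {a b : Fin n} {xs} → Consec a b xs → b ∈ xs
  consec-∈ here      = there (here refl)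
  consec-∈ (there c) = there (consec-∈ c)

module GraphFacts {n : ℕ} (T : Graph n) where

  open DecMembership (_≟_ {n}) using (_∈?_)

  E : Fin n → Fin n → Set
  E = Edge T

  edge-sym : ∀ {x y} → E x y → E y x
  edge-sym {x} {y} e = trans (Graph.sym T y x) e

  edge-irrefl : ∀ {x} → ¬ E x x
  edge-irrefl {x} e with () ← trans (sym e) (Graph.irrefl T x)

  data Walk : Fin n → Fin n → List (Fin n) → Set where
    stop : ∀ {u} → Walk u u (u ∷ [])
    step : ∀ {u x w xs} → E u x → Walk x w (x ∷ xs) → Walk u w (u ∷ x ∷ xs)

  walk-head : ∀ {u w xs} → Walk u w xs → ∃ λ t → xs ≡ u ∷ t
  walk-head stop       = _ , refl
  walk-head (step _ _) = _ , refl

  walk-last : ∀ {u w xs} → Walk u w xs → ∃ λ ini → xs ≡ ini ++ w ∷ []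
  walk-last stop = [] , refl
  walk-last {u} (step _ r) with ini , eq ← walk-last r = u ∷ ini , cong (u ∷_) eq

  walk-linked : ∀ {u w xs} → Walk u w xs → Linked E xs
  walk-linked stop       = [-]
  walk-linked (step e r) = e ∷ walk-linked r

  walk-nonempty : ∀ {u w xs} → Walk u w xs → xs ≢ []
  walk-nonempty stop ()
  walk-nonempty (step _ _) ()

  walk-end : ∀ {u w xs} → Walk u w xs → w ∈ xs
  walk-end stop       = here refl
  walk-end (step _ r) = there (walk-end r)

  prepend : ∀ {u x w xs} → E u x → Walk x w xs → Walk u w (u ∷ xs)
  prepend e stop         = step e stop
  prepend e (step e′ r)  = step e (step e′ r)

  walk-++ : ∀ {u w z xs ys} → Walk u w xs → Walk w z (w ∷ ys) → Walk u z (xs ++ ys)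
  walk-++ stop       s = s
  walk-++ (step e r) s = step e (walk-++ r s)

  walk-reverse : ∀ {u w xs} → Walk u w xs → Walk w u (reverse xs)
  walk-reverse stop = stop
  walk-reverse {u} (step {x = x} {xs = xs} e r) =
    subst (Walk _ u) (sym (unfold-reverse u (x ∷ xs))) (walk-++ (walk-reverse r) (step (edge-sym e) stop))

  walk-split : ∀ {u w z xs} → Walk u w xs → z ∈ xs →
               ∃₂ λ pre suf → xs ≡ pre ++ z ∷ suf × Walk u z (pre ++ z ∷ []) × Walk z w (z ∷ suf)
  walk-split stop       (here refl) = [] , [] , refl , stop , stop
  walk-split (step e r) (here refl) = [] , _ , refl , stop , step e r
  walk-split {u} (step e r) (there z∈) with pre , suf , eq , r₁ , r₂ ← walk-split r z∈ =
    u ∷ pre , suf , cong (u ∷_) eq , prepend e r₁ , r₂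

  walk-reach : ∀ {P u w xs z} → Walk u w xs → All P xs → z ∈ xs → ReachIn T P u z
  walk-reach stop       (p ∷ _)  (here refl) = here p
  walk-reach (step _ _) (p ∷ _)  (here refl) = here p
  walk-reach (step e r) (p ∷ ps) (there z∈)  = there p e (walk-reach r ps z∈)

  reach-start : ∀ {P u w} → ReachIn T P u w → P u
  reach-start (here p)      = p
  reach-start (there p _ _) = p

  reach-end : ∀ {P u w} → ReachIn T P u w → P w
  reach-end (here p)      = p
  reach-end (there _ _ r) = reach-end r

  reach-trans : ∀ {P u w z} → ReachIn T P u w → ReachIn T P w z → ReachIn T P u z
  reach-trans (here _)      s = s
  reach-trans (there p e r) s = there p e (reach-trans r s)

  reach-sym : ∀ {P u w} → ReachIn T P u w → ReachIn T P w u
  reach-sym (here p)          = here p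
  reach-sym {P} (there p e r) = reach-trans (reach-sym r) (there {P = P} (reach-start r) (edge-sym e) (here p))

  reach⇒path : ∀ {P u w} → ReachIn T P u w → ∃ λ xs → Walk u w xs × Unique xs × All P xs
  reach⇒path (here p) = _ , stop , [] ∷ [] , p ∷ []
  reach⇒path {u = u} (there p e r) with xs , wk , U , ps ← reach⇒path r | u ∈? xs
  ... | yes u∈ with pre , suf , refl , _ , wk′ ← walk-split wk u∈ =
    u ∷ suf , wk′ , unique-suffix pre U , AllP.++⁻ʳ pre ps
  ... | no u∉ = u ∷ xs , prepend e wk , AllP.¬Any⇒All¬ xs u∉ ∷ U , p ∷ ps

  neighbours : Fin n → List (Fin n)
  neighbours z = filterᵇ (adj T z) (allFin n)

  ∈-neighbours : ∀ {z x} → E z x → x ∈ neighbours z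
  ∈-neighbours {z} {x} e = ∈-filter⁺ (T? ∘ adj T z) (∈-allFin x) (Equivalence.from T-≡ e)

  neighbours-edge : ∀ {z x} → x ∈ neighbours z → E z x
  neighbours-edge {z} {x} x∈ = Equivalence.to T-≡ (proj₂ (∈-filter⁻ (T? ∘ adj T z) {xs = allFin n} x∈))

  leaf-neighbour : ∀ {w} → IsLeaf T w → ∃ (E w)
  leaf-neighbour {w} leaf with x , x∈ ← singleton-member (neighbours w) leaf = x , neighbours-edge x∈

  leaf-neighbour-unique : ∀ {w x y} → IsLeaf T w → E w x → E w y → x ≡ y
  leaf-neighbour-unique leaf wx wy = singleton-members-equal leaf (∈-neighbours wx) (∈-neighbours wy)

  other-neighbour : ∀ {z p} → ¬ IsLeaf T z → E z p → ∃ λ y → E z y × y ≢ p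
  other-neighbour {z} not-leaf zp
    with y , y∈ , y≢p ←
           another-member (neighbours z) (filter⁺ (T? ∘ adj T z) (allFin⁺ n)) (∈-neighbours zp) not-leaf =
    y , neighbours-edge y∈ , y≢p

  consec-edge : ∀ {a b xs} → Linked E xs → Consec a b xs → E a b
  consec-edge (e ∷ _) here      = e
  consec-edge (_ ∷ l) (there c) = consec-edge l c

  EndOf : Fin n → List (Fin n) → Set
  EndOf w xs = (∃ λ L → Walk w L xs) ⊎ (∃ λ s → Walk s w xs)

  walk-ends-unique : ∀ {s L s′ L′ xs} → Walk s L xs → Walk s′ L′ xs → s ≡ s′ × L ≡ L′
  walk-ends-unique stop       stop        = refl , refl
  walk-ends-unique (step _ r) (step _ r′) = refl , proj₂ (walk-ends-unique r r′)

  -- A leaf can only be passed by a path as one of its ends: an interior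
  -- vertex has two different neighbours on the path.
  leaf-first : ∀ {s L w x xs} → Walk s L xs → Unique xs → IsLeaf T w → Consec w x xs → w ≡ s
  leaf-first (step _ _) _ _ here = refl
  leaf-first {s} (step e r) (s∉ ∷ U) leaf (there c) with refl ← leaf-first r U leaf c =
    ⊥-elim (All.lookup s∉ (consec-∈ c)
             (leaf-neighbour-unique leaf (edge-sym e) (consec-edge (walk-linked r) c)))

  leaf-last : ∀ {s L w x xs} → Walk s L xs → Unique xs → IsLeaf T w → Consec x w xs → w ≡ L
  leaf-last (step _ stop) _ _ here = refl
  leaf-last (step e (step e′ _)) ((_ ∷ s≢x ∷ _) ∷ _) leaf here =
    ⊥-elim (s≢x (leaf-neighbour-unique leaf (edge-sym e) e′))
  leaf-last (step _ r) (_ ∷ U) leaf (there c) = leaf-last r U leaf c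

  leaf-end : ∀ {s L w x xs} → Walk s L xs → Unique xs → IsLeaf T w →
             Consec w x xs ⊎ Consec x w xs → EndOf w xs
  leaf-end wk U leaf (inj₁ c) with refl ← leaf-first wk U leaf c = inj₁ (_ , wk)
  leaf-end wk U leaf (inj₂ c) with refl ← leaf-last wk U leaf c = inj₂ (_ , wk)

  path-walk : (p : Path T) → ∃₂ λ s L → Walk s L (Path.verts p)
  path-walk record { verts = [] ; isPath = nonempty , _ } = ⊥-elim (nonempty refl)
  path-walk record { verts = s ∷ t ; isPath = _ , linked , _ } = s , linked⇒walk linked
    where
      linked⇒walk : ∀ {s t} → Linked E (s ∷ t) → ∃ λ L → Walk s L (s ∷ t)
      linked⇒walk [-]      = _ , stop
      linked⇒walk (e ∷ l) = _ , step e (proj₂ (linked⇒walk l))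

module TreeFacts {n : ℕ} (T : Graph n) (acyclic : Acyclic T) where
  open GraphFacts T

  -- Two different neighbours a, b of c cannot be joined by a walk avoiding
  -- c: a path from a to b would close a cycle through c.
  no-detour : ∀ {a b c} → a ≢ b → E c a → E c b → ¬ ReachIn T (_≢ c) a b
  no-detour {a} {b} {c} a≢b ca cb r with xs , wk , U , avoid ← reach⇒path r | walk-last wk
  ... | [] , refl with stop ← wk = a≢b refl
  ... | _ ∷ mid , refl with _ , refl ← walk-head wk =
    acyclic c (a ∷ mid) b
      ((λ ()) , ca ∷ walk-linked wk , All.map (λ x≢c c≡x → x≢c (sym c≡x)) avoid ∷ U)
      (s≤s z≤n) (edge-sym cb)

  path-unique : ∀ {s t xs ys} → Walk s t xs → Unique xs → Walk s t ys → Unique ys → xs ≡ ys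
  path-unique stop       _ stop        _  = refl
  path-unique stop       _ (step _ r′) U′ = ⊥-elim (Unique[x∷xs]⇒x∉xs U′ (walk-end r′))
  path-unique (step _ r) U stop        _  = ⊥-elim (Unique[x∷xs]⇒x∉xs U (walk-end r))
  path-unique {s} (step {x = x} e r) U@(_ ∷ Ur) (step {x = x′} e′ r′) U′@(_ ∷ Ur′) with x ≟ x′
  ... | yes refl = cong (s ∷_) (path-unique r Ur r′ Ur′)
  ... | no x≢x′  = ⊥-elim (no-detour x≢x′ e e′
                    (reach-trans (walk-reach r (head-avoided U) (walk-end r))
                                 (reach-sym (walk-reach r′ (head-avoided U′) (walk-end r′)))))

  fresh-neighbour : ∀ {z p w xs y} → Walk z w (z ∷ p ∷ xs) → Unique (z ∷ p ∷ xs) →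
                    E z y → y ≢ p → y ∉ z ∷ p ∷ xs
  fresh-neighbour _           _ zy _   (here refl) = edge-irrefl zy
  fresh-neighbour (step zp r) U zy y≢p (there y∈)  =
    no-detour (y≢p ∘ sym) zp zy (walk-reach r (head-avoided U) y∈)

  record LeafExtension (v : Fin n) (Q : List (Fin n)) : Set where
    field
      leaf       : Fin n
      verts      : List (Fin n)
      walk       : Walk leaf v verts
      unique     : Unique verts
      is-leaf    : IsLeaf T leaf
      leaf≢v     : leaf ≢ v
      keeps-edges : ∀ {a b} → Consec a b Q → Consec a b verts

  extends-tail : ∀ {v y Q} → LeafExtension v (y ∷ Q) → LeafExtension v Q
  extends-tail e = record { LeafExtension e ; keeps-edges = LeafExtension.keeps-edges e ∘ there }

  -- Keep stepping to a new neighbour until a leaf is reached; this stops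
  -- since the path grows and has at most n vertices.
  extend-to-leaf : ∀ {v z Q} → Walk z v Q → Unique Q → z ≢ v → LeafExtension v Q
  extend-to-leaf {v} {Q = Q} wk U z≢v =
    go (suc n) wk U z≢v (subst (n <_) (sym (+-suc (length Q) n)) (s≤s (m≤n+m n (length Q))))
    where
      go : ∀ fuel {z Q} → Walk z v Q → Unique Q → z ≢ v → n < length Q + fuel → LeafExtension v Q
      go zero {Q = Q} _ U _ n<|Q| =
        ⊥-elim (1+n≰n (≤-trans (subst (n <_) (+-identityʳ (length Q)) n<|Q|) (unique-Fin-length≤ U)))
      go (suc fuel) {z} wk U z≢v n< with degree T z ≟ℕ 1
      ... | yes leaf = record { leaf = z ; verts = _ ; walk = wk ; unique = U ; is-leaf = leaf
                              ; leaf≢v = z≢v ; keeps-edges = id }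
      go (suc fuel) stop _ z≢v _ | no _ = ⊥-elim (z≢v refl)
      go (suc fuel) {Q = Q} wk@(step zp _) U z≢v n< | no not-leaf
        with y , zy , y≢p ← other-neighbour not-leaf zp =
        extends-tail extension
        where
          y∉Q = fresh-neighbour wk U zy y≢p
          extension = go fuel (step (edge-sym zy) wk) (AllP.¬Any⇒All¬ Q y∉Q ∷ U)
                        (λ y≡v → y∉Q (subst (_∈ Q) (sym y≡v) (walk-end wk)))
                        (subst (n <_) (+-suc (length Q) fuel) n<)

  ends-separated : ∀ {v s L xs} → Walk s L xs → Unique xs → v ∈ xs → s ≢ v → L ≢ v →
                   ¬ ReachIn T (_≢ v) s L
  ends-separated stop       _ (here refl) s≢v _ _ = s≢v refl
  ends-separated (step _ _) _ (here refl) s≢v _ _ = s≢v refl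
  ends-separated {v} (step {x = x} e r) U@(_ ∷ Ur) (there v∈) s≢v L≢v sL with x ≟ v
  ... | no x≢v = ends-separated r Ur v∈ x≢v L≢v (there x≢v (edge-sym e) sL)
  ends-separated (step e stop) _ _ _ L≢v _ | yes refl = L≢v refl
  ends-separated (step e (step vb r)) ((_ ∷ s≢b ∷ _) ∷ Ur) _ _ _ sL | yes refl =
    no-detour s≢b (edge-sym e) vb (reach-trans sL (reach-sym (walk-reach r (head-avoided Ur) (walk-end r))))

  one-end-per-component : ∀ {v xs w₁ w₂} → Unique xs → v ∈ xs → EndOf w₁ xs → EndOf w₂ xs →
                          ReachIn T (_≢ v) w₁ w₂ → w₁ ≡ w₂
  one-end-per-component _ _ (inj₁ (_ , wk₁)) (inj₁ (_ , wk₂)) _ = proj₁ (walk-ends-unique wk₁ wk₂)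
  one-end-per-component _ _ (inj₂ (_ , wk₁)) (inj₂ (_ , wk₂)) _ = proj₂ (walk-ends-unique wk₁ wk₂)
  one-end-per-component U v∈ (inj₁ (_ , wk₁)) (inj₂ (_ , wk₂)) r
    with refl , refl ← walk-ends-unique wk₁ wk₂ =
    ⊥-elim (ends-separated wk₁ U v∈ (reach-start r) (reach-end r) r)
  one-end-per-component U v∈ (inj₂ (_ , wk₁)) (inj₁ (_ , wk₂)) r
    with refl , refl ← walk-ends-unique wk₁ wk₂ =
    ⊥-elim (ends-separated wk₂ U v∈ (reach-end r) (reach-start r) (reach-sym r))

covering⇒leaf-bounded : ∀ {n} (T : Graph n) → Acyclic T → ∀ v k →
                        CoveringThrough T k v → ComponentsLeafBounded T k v
covering⇒leaf-bounded {n} T acyclic v k (ps , through , covers) u ws U in-component =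
  count-by-labels Ends U (All.map end-of-some-path in-component) separated
  where
    open GraphFacts T
    open TreeFacts T acyclic

    Ends : Fin n → Fin k → Set
    Ends w i = EndOf w (Path.verts (ps i))

    end-of-some-path : ∀ {w} → IsLeaf T w × ReachIn T (_≢ v) u w → ∃ (Ends w)
    end-of-some-path {w} (leaf , _) with x , wx ← leaf-neighbour leaf with i , on-path ← covers w x wx =
      i , leaf-end (proj₂ (proj₂ (path-walk (ps i)))) (proj₂ (proj₂ (Path.isPath (ps i)))) leaf on-path

    separated : Separated Ends ws
    separated {i = i} w∈ w′∈ end end′ =
      one-end-per-component (proj₂ (proj₂ (Path.isPath (ps i)))) (through i) end end′
        (reach-trans (reach-sym (proj₂ (All.lookup in-component w∈))) (proj₂ (All.lookup in-component w′∈)))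

module Rays {n : ℕ} (T : Graph n) (tree : IsTree T) (v : Fin n) where
  open GraphFacts T
  open TreeFacts T (proj₂ tree)
  open DecMembership (_≟_ {n}) using (_∈?_)

  ray-path : ∀ x → ∃ λ xs → Walk v x xs × Unique xs × All (λ _ → ⊤) xs
  ray-path x = reach⇒path (proj₁ tree v x)

  ray : Fin n → List (Fin n)
  ray x = proj₁ (ray-path x)

  ray-walk : ∀ x → Walk v x (ray x)
  ray-walk x = proj₁ (proj₂ (ray-path x))

  ray-unique : ∀ x → Unique (ray x)
  ray-unique x = proj₁ (proj₂ (proj₂ (ray-path x)))

  ray-tail : Fin n → List (Fin n)
  ray-tail x = proj₁ (walk-head (ray-walk x))

  ray≡ : ∀ x → ray x ≡ v ∷ ray-tail x
  ray≡ x = proj₂ (walk-head (ray-walk x))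

  v∈ray : ∀ x → v ∈ ray x
  v∈ray x = subst (v ∈_) (sym (ray≡ x)) (here refl)

  ray-tail-unique : ∀ x → Unique (v ∷ ray-tail x)
  ray-tail-unique x = subst Unique (ray≡ x) (ray-unique x)

  ∈-ray-tail : ∀ x → x ≢ v → x ∈ ray-tail x
  ∈-ray-tail x x≢v with subst (x ∈_) (ray≡ x) (walk-end (ray-walk x))
  ... | here x≡v  = ⊥-elim (x≢v x≡v)
  ... | there x∈ = x∈

  -- key x is the vertex after v on ray x (v itself if x = v)
  first-or-v : List (Fin n) → Fin n
  first-or-v []      = v
  first-or-v (y ∷ _) = y

  key : Fin n → Fin n
  key x = first-or-v (ray-tail x)

  beyond-v : ∀ x {z} → z ∈ ray-tail x → E v (key x) × ReachIn T (_≢ v) (key x) z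
  beyond-v x = along (subst (Walk v x) (ray≡ x) (ray-walk x)) (head-avoided (ray-tail-unique x))
    where
      along : ∀ {t z} → Walk v x (v ∷ t) → All (_≢ v) t → z ∈ t →
              E v (first-or-v t) × ReachIn T (_≢ v) (first-or-v t) z
      along (step e r) avoid z∈ = e , walk-reach r avoid z∈

  not-both-on-rays : ∀ {a b} → E a b → b ∈ ray a → a ∉ ray b
  not-both-on-rays {a} {b} ab b∈ a∈ with pre , suf , ray-a≡ , to-b , b-to-a ← walk-split (ray-walk a) b∈ =
    unique-disjoint pre unique-a a∈pre (there a∈suf)
    where
      unique-a : Unique (pre ++ b ∷ suf)
      unique-a = subst Unique ray-a≡ (ray-unique a)
      ray-b≡ : pre ++ b ∷ [] ≡ ray b
      ray-b≡ = path-unique to-b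
                 (unique-prefix (pre ++ b ∷ []) (subst Unique (sym (++-assoc pre (b ∷ []) suf)) unique-a))
                 (ray-walk b) (ray-unique b)
      a≢b : a ≢ b
      a≢b refl = edge-irrefl ab
      a∈pre : a ∈ pre
      a∈pre with ∈-++⁻ pre (subst (a ∈_) (sym ray-b≡) a∈)
      ... | inj₁ a∈′        = a∈′
      ... | inj₂ (here a≡b) = ⊥-elim (a≢b a≡b)
      a∈suf : a ∈ suf
      a∈suf with walk-end b-to-a
      ... | here a≡b = ⊥-elim (a≢b a≡b)
      ... | there a∈′ = a∈′

  -- If b is not on the ray of a, the path b a … v can be prolonged away
  -- from v to a leaf z, and then ab lies on the ray of z.
  edge-away-from-v : ∀ {a b} → E a b → b ∉ ray a → ∃ λ z → (IsLeaf T z × z ≢ v) × Consec a b (ray z)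
  edge-away-from-v {a} {b} ab b∉ =
    leaf , (is-leaf , leaf≢v) ,
    subst (Consec a b) (path-unique (walk-reverse walk) (unique-reverse unique) (ray-walk leaf) (ray-unique leaf))
      (consec-reverse (keeps-edges ba))
    where
      back : Walk a v (reverse (ray a))
      back = walk-reverse (ray-walk a)
      b∉back : b ∉ reverse (ray a)
      b∉back = b∉ ∘ Any.reverse⁻
      b≢v : b ≢ v
      b≢v refl = b∉ (v∈ray a)
      ba : Consec b a (b ∷ reverse (ray a))
      ba with t , eq ← walk-head back = subst (λ l → Consec b a (b ∷ l)) (sym eq) here
      open LeafExtension (extend-to-leaf (prepend (edge-sym ab) back)
                            (AllP.¬Any⇒All¬ _ b∉back ∷ unique-reverse (ray-unique a)) b≢v)

  edge-on-leaf-ray : ∀ {a b} → E a b → ∃ λ z → (IsLeaf T z × z ≢ v) × (Consec a b (ray z) ⊎ Consec b a (ray z))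
  edge-on-leaf-ray {a} {b} ab with b ∈? ray a
  ... | no b∉  = Product.map₂ (Product.map₂ inj₁) (edge-away-from-v ab b∉)
  ... | yes b∈ = Product.map₂ (Product.map₂ inj₂) (edge-away-from-v (edge-sym ab) (not-both-on-rays ab b∈))

  Through : Set
  Through = Σ (Path T) λ p → v ∈ Path.verts p

  Carries : Through → Fin n → Set
  Carries (p , _) x = ∀ {a b} → Consec a b (ray x) → EdgeInPath {G = T} a b p

  as-path : ∀ {s t xs} → Walk s t xs → Unique xs → Path T
  as-path wk U = record { verts = _ ; isPath = walk-nonempty wk , walk-linked wk , U }

  ray-through : ∀ x → Σ Through λ q → Carries q x
  ray-through x = (as-path (ray-walk x) (ray-unique x) , v∈ray x) , inj₁

  reverse-ray-++ : ∀ x t → ∃ λ ini → reverse (ray x) ++ t ≡ ini ++ v ∷ t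
  reverse-ray-++ x t with ini , eq ← walk-last (walk-reverse (ray-walk x)) =
    ini , trans (cong (_++ t) eq) (++-assoc ini (v ∷ []) t)

  -- Rays with different keys meet only in v (a common vertex beyond v
  -- would join the two keys avoiding v), so together they form a path.
  joined-rays : ∀ x y → key x ≢ key y → Σ Through λ q → Carries q x × Carries q y
  joined-rays x y keys≢ = (as-path joined unique , ∈-++⁺ˡ (Any.reverse⁺ (v∈ray x))) , carries-x , carries-y
    where
      joined : Walk x y (reverse (ray x) ++ ray-tail y)
      joined = walk-++ (walk-reverse (ray-walk x)) (subst (Walk v y) (ray≡ y) (ray-walk y))
      disjoint : Disjoint (reverse (ray x)) (ray-tail y)
      disjoint {z} (z∈x , z∈y) with subst (z ∈_) (ray≡ x) (Any.reverse⁻ z∈x)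
      ... | here refl = All.lookup (head-avoided (ray-tail-unique y)) z∈y refl
      ... | there z∈x′ with vx , rx ← beyond-v x z∈x′ | vy , ry ← beyond-v y z∈y =
        no-detour keys≢ vx vy (reach-trans rx (reach-sym ry))
      unique : Unique (reverse (ray x) ++ ray-tail y)
      unique = UniqueP.++⁺ (unique-reverse (ray-unique x)) (unique-suffix (v ∷ []) (ray-tail-unique y)) disjoint
      carries-x : ∀ {a b} → Consec a b (ray x) → EdgeInPath {G = T} a b (as-path joined unique)
      carries-x c = inj₂ (consec-++ˡ _ (consec-reverse c))
      carries-y : ∀ {a b} → Consec a b (ray y) → EdgeInPath {G = T} a b (as-path joined unique)
      carries-y c with ini , eq ← reverse-ray-++ x (ray-tail y) =
        inj₁ (subst (Consec _ _) (sym eq) (consec-++ʳ ini (subst (Consec _ _) (ray≡ y) c)))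

module Backward {n : ℕ} (T : Graph n) (tree : IsTree T) (v : Fin n) where
  open GraphFacts T
  open Rays T tree v
  open Pairing (toℕ ∘ key)

  group-path : (g : Group) → Σ Through λ q → ∀ {x} → x ∈ᴳ g → Carries q x
  group-path (single x) with q , carries ← ray-through x = q , λ { in-single → carries }
  group-path (pair x y d) with q , carries-x , carries-y ← joined-rays x y (d ∘ cong toℕ) =
    q , λ { in-left → carries-x ; in-right → carries-y }

  OuterLeaf : Fin n → Set
  OuterLeaf x = IsLeaf T x × x ≢ v

  outer-leaves : List (Fin n)
  outer-leaves = filter (λ x → (degree T x ≟ℕ 1) ×-dec ¬? (x ≟ v)) (allFin n)

  outer-leaves-unique : Unique outer-leaves
  outer-leaves-unique = filter⁺ _ (allFin⁺ n)

  ∈-outer-leaves : ∀ {x} → OuterLeaf x → x ∈ outer-leaves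
  ∈-outer-leaves {x} outer = ∈-filter⁺ _ (∈-allFin x) outer

  outer-leaves-sound : ∀ {x} → x ∈ outer-leaves → OuterLeaf x
  outer-leaves-sound x∈ = proj₂ (∈-filter⁻ _ {xs = allFin n} x∈)

  outer-leaves≤ℓ : length outer-leaves ≤ leafCount T
  outer-leaves≤ℓ = unique-length≤ outer-leaves-unique (All.tabulate λ {x} x∈ →
    ∈-filter⁺ (T? ∘ λ y → degree T y ≡ᵇ 1) (∈-allFin x) (≡⇒≡ᵇ _ _ (proj₁ (outer-leaves-sound x∈))))

  -- leaves sharing a key lie in one component of T - v
  key-bounded : ∀ {k} → ComponentsLeafBounded T k v → KeyBounded k outer-leaves
  key-bounded H a ys U members = H (key a) ys U (All.map in-component members)
    where
      in-component : ∀ {y} → y ∈ outer-leaves × toℕ (key y) ≡ toℕ (key a) →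
                     IsLeaf T y × ReachIn T (_≢ v) (key a) y
      in-component {y} (y∈ , same) with leaf , y≢v ← outer-leaves-sound y∈ =
        leaf , subst (λ u → ReachIn T (_≢ v) u y) (toℕ-injective same) (proj₂ (beyond-v y (∈-ray-tail y y≢v)))

  -- cover T by the paths of the groups, padded with the path of the group of
  -- v alone, i.e. the one-vertex path v
  leaf-bounded⇒covering : ∀ k → leafCount T ≤ k + k → ComponentsLeafBounded T k v → CoveringThrough T k v
  leaf-bounded⇒covering k ℓ≤2k H
    with gs , |gs|≤k , grouped ←
           pairing k outer-leaves outer-leaves-unique (≤-trans outer-leaves≤ℓ ℓ≤2k) (key-bounded H) =
    proj₁ ∘ path , proj₂ ∘ path , covers
    where
      path : Fin k → Through
      path i = proj₁ (group-path (padded (single v) gs i))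
      covers : ∀ a b → E a b → ∃ λ i → EdgeInPath {G = T} a b (proj₁ (path i))
      covers a b ab with z , outer , on-ray ← edge-on-leaf-ray ab
                    with i , z∈g ← padded-any (single v) |gs|≤k (grouped (∈-outer-leaves outer))
                    with on-ray
      ... | inj₁ c = i , proj₂ (group-path _) z∈g c
      ... | inj₂ c = i , Sum.swap (proj₂ (group-path _) z∈g c)

ℓ≤⌈ℓ/2⌉+⌈ℓ/2⌉ : ∀ ℓ → ℓ ≤ ⌈ ℓ /2⌉ + ⌈ ℓ /2⌉
ℓ≤⌈ℓ/2⌉+⌈ℓ/2⌉ ℓ = subst (_≤ ⌈ ℓ /2⌉ + ⌈ ℓ /2⌉) (⌊n/2⌋+⌈n/2⌉≡n ℓ) (+-monoˡ-≤ ⌈ ℓ /2⌉ (⌊n/2⌋≤⌈n/2⌉ ℓ))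

mainTheorem6 : ∀ {n : ℕ} (T : Graph n) → IsTree T → (v : Fin n) →
               CoveringThrough T ⌈ leafCount T /2⌉ v ⇔ ComponentsLeafBounded T ⌈ leafCount T /2⌉ v
mainTheorem6 T tree v =
  mk⇔ (covering⇒leaf-bounded T (proj₂ tree) v k)
      (Backward.leaf-bounded⇒covering T tree v k (ℓ≤⌈ℓ/2⌉+⌈ℓ/2⌉ (leafCount T)))
  where
    k = ⌈ leafCount T /2⌉
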